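{- Let $G$ be an abelian group and let $A,A'$ be finite multisets with elements in $G$. Then: (1) If $A\sim_0 A'$ then $\mathrm{FS}(A)=\mathrm{FS}(A')$. (2) If $A\sim A'$, then there is $g\in G$ such that $\mathrm{FS}(A)=\mathrm{FS}(A')+g$. (3) If $G$ has no elements of order $2$, $\mathrm{FS}(A)=\mathrm{FS}(A')$ and $A\sim A'$, then $A\sim_0 A'$. (4) If $\mathrm{FS}(A)=\mathrm{FS}(A')+g$ for some $g\in G$, then there exists a finite multiset $A''$ in $G$ with $A''\sim A'$ and $\mathrm{FS}(A)=\mathrm{FS}(A'')$.
   Context: Multisets: a finite multiset $A$ in a set $X$ is a function $\mu_A:X\to\mathbb Z_{\ge0}$ with finite total sum; inclusion, union (adding multiplicities), difference are in the multiset sense, and subsets are counted with multiplicity. For a finite multiset $A=\{a_1,\dots,a_k\}$ in $G$, $\mathrm{FS}(A)$ is the multiset of the $2^k$ sums $\sum_{i\in I}a_i$, $I\subseteq\{1,\dots,k\}$. For a multiset $C$ and $g\in G$, $C+g=\{c+g:c\in C\}$ and $-B=\{ -b:b\in B\}$ (multisets). $A\sim A'$ means there is $B\subseteq A$ with $A'=(A\setminus B)\cup(-B)$; $A\sim_0A'$ means there is $B\subseteq A$ with $\sum_{b\in B}b=0$ and $A'=(A\setminus B)\cup(-B)$. -}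

module Defs where

open import Level using (Level; _⊔_)
open import Algebra.Bundles using (AbelianGroup)
open import Data.List using (List; []; _∷_; _++_; map; foldr)
open import Data.Product using (Σ; ∃; ∃-syntax; _×_; _,_)
import Data.List.Relation.Binary.Permutation.Setoid as Perm

-- Finite multisets in G are represented by lists of elements of G;
-- equality of multisets is permutation up to the group's setoid equality.
module MS {c ℓ : Level} (G : AbelianGroup c ℓ) where
  open AbelianGroup G

  MSet : Set c
  MSet = List Carrier

  _≐_ : MSet → MSet → Set (c ⊔ ℓ)
  _≐_ = Perm._↭_ setoid

  Σ⟨_⟩ : MSet → Carrier
  Σ⟨ xs ⟩ = foldr _∙_ ε xs

  FS : MSet → MSet
  FS [] = ε ∷ []
  FS (a ∷ A) = FS A ++ map (a ∙_) (FS A)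

  _⊕_ : MSet → Carrier → MSet
  C ⊕ g = map (_∙ g) C

  neg : MSet → MSet
  neg B = map _⁻¹ B

  -- A ∼ A' : there is a sub-multiset B ⊆ A (with complement A \ B = C,
  -- i.e. A = B ∪ C) such that A' = (A \ B) ∪ (-B)
  _∼_ : MSet → MSet → Set (c ⊔ ℓ)
  A ∼ A' = ∃[ B ] ∃[ C ] (A ≐ (B ++ C) × A' ≐ (C ++ neg B))

  _∼₀_ : MSet → MSet → Set (c ⊔ ℓ)
  A ∼₀ A' = ∃[ B ] ∃[ C ] (A ≐ (B ++ C) × Σ⟨ B ⟩ ≈ ε × A' ≐ (C ++ neg B))

  NoOrder2 : Set (c ⊔ ℓ)
  NoOrder2 = ∀ x → x ∙ x ≈ ε → x ≈ ε

-- Changing the sign of one element b only translates the subset sums: a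
-- subset of X ∪ {-b} containing -b corresponds to the subset of X ∪ {b}
-- without b and vice versa, so FS(X ∪ {-b}) = FS(X ∪ {b}) - b.
-- Iterating over B, FS((A \ B) ∪ (-B)) = FS(A) - ΣB, which gives (1) and (2).
-- For (3), summing both sides of FS(A) = FS(A) - ΣB over all 2^k subset
-- sums gives 2^k · ΣB = 0, hence ΣB = 0 when G has no element of order 2.
-- For (4), FS(A) contains 0, so 0 = s + g for a subset sum s = ΣB of A',
-- and flipping the signs of B translates FS(A') by -ΣB = g.
module Submission where

open import Defs
open import Level using (Level)
open import Algebra.Bundles using (AbelianGroup)
open import Data.Product using (∃-syntax; _×_; _,_)
open import Data.Nat using (zero; suc; _+_; _^_)
import Data.Nat.Properties as ℕP
open import Data.List using (List; []; _∷_; _++_; map; length)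
import Data.List.Properties as LP
import Data.List.Relation.Binary.Permutation.Setoid as PermS
import Data.List.Relation.Binary.Permutation.Setoid.Properties as PermP
import Data.List.Relation.Binary.Equality.Setoid as EqS
open import Data.List.Relation.Binary.Pointwise using ([]; _∷_)
open import Data.List.Relation.Unary.Any using (Any; here)
import Data.List.Relation.Unary.Any.Properties as AnyP
open import Data.Sum using (inj₁; inj₂)
import Relation.Binary.PropositionalEquality as ≡
import Algebra.Properties.AbelianGroup as AbelianGroupProperties
import Algebra.Properties.CommutativeSemigroup as CommutativeSemigroupProperties
import Algebra.Properties.Monoid.Mult as MonoidMult
import Relation.Binary.Reasoning.Setoid as SetoidReasoning

module SubsetSums {c ℓ : Level} (G : AbelianGroup c ℓ) where
  open AbelianGroup G
  open MS G
  open PermS setoid using (↭-refl; ↭-sym; ↭-trans; ↭-prep; module PermutationReasoning)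
  open EqS setoid using (_≋_)
  module PP = PermP setoid
  open AbelianGroupProperties G
    using (⁻¹-∙-comm; ε⁻¹≈ε; ⁻¹-involutive; ⁻¹-injective; inverseʳ-unique; identityʳ-unique; xyx⁻¹≈y)
  open CommutativeSemigroupProperties commutativeSemigroup using (interchange; x∙yz≈y∙xz)
  open MonoidMult monoid using (×-congˡ; ×-assocˡ) renaming (_×_ to _·_)

  map-cong-≈ : ∀ {f g : Carrier → Carrier} → (∀ x → f x ≈ g x) → ∀ X → map f X ≐ map g X
  map-cong-≈ f≈g []      = ↭-refl
  map-cong-≈ f≈g (x ∷ X) = PermS.prep (f≈g x) (map-cong-≈ f≈g X)

  map-∙-comm : ∀ x y X → map (x ∙_) (map (y ∙_) X) ≐ map (y ∙_) (map (x ∙_) X)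
  map-∙-comm x y []      = ↭-refl
  map-∙-comm x y (z ∷ X) = PermS.prep (x∙yz≈y∙xz x y z) (map-∙-comm x y X)

  neg-involutive : ∀ B → B ≐ neg (neg B)
  neg-involutive []      = ↭-refl
  neg-involutive (b ∷ B) = PermS.prep (sym (⁻¹-involutive b)) (neg-involutive B)

  Σ-cong : ∀ {X Y} → X ≐ Y → Σ⟨ X ⟩ ≈ Σ⟨ Y ⟩
  Σ-cong = PP.foldr-commMonoid isCommutativeMonoid

  ⊕-congˡ : ∀ X {g h} → g ≈ h → (X ⊕ g) ≐ (X ⊕ h)
  ⊕-congˡ X g≈h = map-cong-≈ (λ x → ∙-congˡ g≈h) X

  ⊕-congʳ : ∀ g {X Y} → X ≐ Y → (X ⊕ g) ≐ (Y ⊕ g)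
  ⊕-congʳ g = PP.map⁺ setoid ∙-congʳ

  ⊕-assoc : ∀ X g h → ((X ⊕ g) ⊕ h) ≐ (X ⊕ (g ∙ h))
  ⊕-assoc []      g h = ↭-refl
  ⊕-assoc (x ∷ X) g h = PermS.prep (assoc x g h) (⊕-assoc X g h)

  ⊕-identityʳ : ∀ X → (X ⊕ ε) ≐ X
  ⊕-identityʳ []      = ↭-refl
  ⊕-identityʳ (x ∷ X) = PermS.prep (identityʳ x) (⊕-identityʳ X)

  map-∙-⊕ : ∀ b g X → map (b ∙_) (X ⊕ g) ≐ (map (b ∙_) X ⊕ g)
  map-∙-⊕ b g []      = ↭-refl
  map-∙-⊕ b g (x ∷ X) = PermS.prep (sym (assoc b x g)) (map-∙-⊕ b g X)

  Σ-⊕ : ∀ X g → Σ⟨ X ⊕ g ⟩ ≈ Σ⟨ X ⟩ ∙ (length X · g)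
  Σ-⊕ []      g = sym (identityʳ ε)
  Σ-⊕ (x ∷ X) g = trans (∙-congˡ (Σ-⊕ X g)) (interchange x g Σ⟨ X ⟩ (length X · g))

  FS-∷-cong : ∀ {x y} X Y → x ≈ y → FS X ≐ FS Y → FS (x ∷ X) ≐ FS (y ∷ Y)
  FS-∷-cong X Y x≈y FSX≐FSY =
    PP.++⁺ FSX≐FSY (↭-trans (PP.map⁺ setoid ∙-congˡ FSX≐FSY)
                            (map-cong-≈ (λ z → ∙-congʳ x≈y) (FS Y)))

  FS-swap : ∀ x y X → FS (x ∷ y ∷ X) ≐ FS (y ∷ x ∷ X)
  FS-swap x y X = begin
    (F ++ yF) ++ map (x ∙_) (F ++ yF)  ≡⟨ ≡.cong ((F ++ yF) ++_) (LP.map-++ (x ∙_) F yF) ⟩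
    (F ++ yF) ++ xF ++ map (x ∙_) yF   ≡⟨ LP.++-assoc F yF _ ⟩
    F ++ yF ++ xF ++ map (x ∙_) yF     ↭⟨ PP.++⁺ˡ F (PP.shifts yF xF) ⟩
    F ++ xF ++ yF ++ map (x ∙_) yF     ↭⟨ PP.++⁺ˡ F (PP.++⁺ˡ xF (PP.++⁺ˡ yF (map-∙-comm x y F))) ⟩
    F ++ xF ++ yF ++ map (y ∙_) xF     ≡⟨ LP.++-assoc F xF _ ⟨
    (F ++ xF) ++ yF ++ map (y ∙_) xF   ≡⟨ ≡.cong ((F ++ xF) ++_) (LP.map-++ (y ∙_) F xF) ⟨
    (F ++ xF) ++ map (y ∙_) (F ++ xF)  ∎
    where
    open PermutationReasoning
    F  = FS X
    xF = map (x ∙_) F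
    yF = map (y ∙_) F

  FS-cong-≋ : ∀ {X Y} → X ≋ Y → FS X ≐ FS Y
  FS-cong-≋ []                          = ↭-refl
  FS-cong-≋ {_ ∷ X} {_ ∷ Y} (x≈y ∷ X≋Y) = FS-∷-cong X Y x≈y (FS-cong-≋ X≋Y)

  FS-cong : ∀ {X Y} → X ≐ Y → FS X ≐ FS Y
  FS-cong (PermS.refl X≋Y)             = FS-cong-≋ X≋Y
  FS-cong (PermS.prep {X} {Y} x≈y X↭Y) = FS-∷-cong X Y x≈y (FS-cong X↭Y)
  FS-cong (PermS.swap {X} {Y} {x} {y} {x′} {y′} x≈x′ y≈y′ X↭Y) =
    ↭-trans (FS-swap x y X) (FS-∷-cong (x ∷ X) (x′ ∷ Y) y≈y′ (FS-∷-cong X Y x≈x′ (FS-cong X↭Y)))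
  FS-cong (PermS.trans X↭Y Y↭Z)        = ↭-trans (FS-cong X↭Y) (FS-cong Y↭Z)

  FS-∷-⊕ : ∀ {g} b X Y → FS X ≐ (FS Y ⊕ g) → FS (b ∷ X) ≐ (FS (b ∷ Y) ⊕ g)
  FS-∷-⊕ {g} b X Y FSX≐FSY⊕g = begin
    FS X ++ map (b ∙_) (FS X)              ↭⟨ PP.++⁺ FSX≐FSY⊕g (PP.map⁺ setoid ∙-congˡ FSX≐FSY⊕g) ⟩
    (FS Y ⊕ g) ++ map (b ∙_) (FS Y ⊕ g)    ↭⟨ PP.++⁺ˡ (FS Y ⊕ g) (map-∙-⊕ b g (FS Y)) ⟩
    (FS Y ⊕ g) ++ (map (b ∙_) (FS Y) ⊕ g)  ≡⟨ LP.map-++ (_∙ g) (FS Y) _ ⟨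
    (FS Y ++ map (b ∙_) (FS Y)) ⊕ g        ∎
    where open PermutationReasoning

  FS-⁻¹∷ : ∀ b X → FS (b ⁻¹ ∷ X) ≐ (FS (b ∷ X) ⊕ (b ⁻¹))
  FS-⁻¹∷ b X = begin
    F ++ map (b ⁻¹ ∙_) F                     ↭⟨ PP.++-comm F _ ⟩
    map (b ⁻¹ ∙_) F ++ F                     ↭⟨ PP.++⁺ (map-cong-≈ (comm (b ⁻¹)) F) F≐bF⊕b⁻¹ ⟩
    (F ⊕ (b ⁻¹)) ++ (map (b ∙_) F ⊕ (b ⁻¹))  ≡⟨ LP.map-++ (_∙ (b ⁻¹)) F _ ⟨
    (F ++ map (b ∙_) F) ⊕ (b ⁻¹)             ∎
    where
    open PermutationReasoning
    F = FS X
    F≐bF⊕b⁻¹ : F ≐ (map (b ∙_) F ⊕ (b ⁻¹))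
    F≐bF⊕b⁻¹ = begin
      F                           ≡⟨ LP.map-id F ⟨
      map (λ y → y) F             ↭⟨ map-cong-≈ (λ y → sym (xyx⁻¹≈y b y)) F ⟩
      map (λ y → b ∙ y ∙ b ⁻¹) F  ≡⟨ LP.map-∘ F ⟩
      map (b ∙_) F ⊕ (b ⁻¹)       ∎

  FS-neg-++ : ∀ B C → FS (neg B ++ C) ≐ (FS (B ++ C) ⊕ (Σ⟨ B ⟩ ⁻¹))
  FS-neg-++ []      C = ↭-sym (↭-trans (⊕-congˡ (FS C) ε⁻¹≈ε) (⊕-identityʳ (FS C)))
  FS-neg-++ (b ∷ B) C = begin
    FS (b ⁻¹ ∷ neg B ++ C)                    ↭⟨ FS-∷-⊕ (b ⁻¹) (neg B ++ C) (B ++ C) (FS-neg-++ B C) ⟩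
    FS (b ⁻¹ ∷ B ++ C) ⊕ (Σ⟨ B ⟩ ⁻¹)          ↭⟨ ⊕-congʳ (Σ⟨ B ⟩ ⁻¹) (FS-⁻¹∷ b (B ++ C)) ⟩
    (FS (b ∷ B ++ C) ⊕ (b ⁻¹)) ⊕ (Σ⟨ B ⟩ ⁻¹)  ↭⟨ ⊕-assoc (FS (b ∷ B ++ C)) (b ⁻¹) (Σ⟨ B ⟩ ⁻¹) ⟩
    FS (b ∷ B ++ C) ⊕ (b ⁻¹ ∙ Σ⟨ B ⟩ ⁻¹)      ↭⟨ ⊕-congˡ (FS (b ∷ B ++ C)) (⁻¹-∙-comm b Σ⟨ B ⟩) ⟩
    FS (b ∷ B ++ C) ⊕ ((b ∙ Σ⟨ B ⟩) ⁻¹)       ∎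
    where open PermutationReasoning

  FS-flip : ∀ {A A'} B C → A ≐ (B ++ C) → A' ≐ (C ++ neg B) → FS A' ≐ (FS A ⊕ (Σ⟨ B ⟩ ⁻¹))
  FS-flip {A} {A'} B C A≐B++C A'≐C++negB = begin
    FS A'                      ↭⟨ FS-cong (↭-trans A'≐C++negB (PP.++-comm C (neg B))) ⟩
    FS (neg B ++ C)            ↭⟨ FS-neg-++ B C ⟩
    FS (B ++ C) ⊕ (Σ⟨ B ⟩ ⁻¹)  ↭⟨ ⊕-congʳ (Σ⟨ B ⟩ ⁻¹) (FS-cong A≐B++C) ⟨
    FS A ⊕ (Σ⟨ B ⟩ ⁻¹)         ∎
    where open PermutationReasoning

  length-FS : ∀ A → length (FS A) ≡.≡ 2 ^ length A
  length-FS []      = ≡.refl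
  length-FS (a ∷ A) = begin
    length (FS A ++ map (a ∙_) (FS A))          ≡⟨ LP.length-++ (FS A) ⟩
    length (FS A) + length (map (a ∙_) (FS A))  ≡⟨ ≡.cong (length (FS A) +_) (LP.length-map (a ∙_) (FS A)) ⟩
    length (FS A) + length (FS A)               ≡⟨ ≡.cong (λ n → n + n) (length-FS A) ⟩
    2 ^ length A + 2 ^ length A                 ≡⟨ ≡.cong (2 ^ length A +_) (ℕP.+-identityʳ (2 ^ length A)) ⟨
    2 ^ suc (length A)                          ∎
    where open ≡.≡-Reasoning

  2^k·t≈ε⇒t≈ε : NoOrder2 → ∀ k {t} → (2 ^ k) · t ≈ ε → t ≈ ε
  2^k·t≈ε⇒t≈ε noOrder2 zero    {t} 1·t≈ε = trans (sym (identityʳ t)) 1·t≈ε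
  2^k·t≈ε⇒t≈ε noOrder2 (suc k) {t} 2^k+1·t≈ε = 2^k·t≈ε⇒t≈ε noOrder2 k (noOrder2 y (begin
    y ∙ y            ≈⟨ ∙-congˡ (identityʳ y) ⟨
    2 · y            ≈⟨ ×-assocˡ t 2 (2 ^ k) ⟩
    (2 ^ suc k) · t  ≈⟨ 2^k+1·t≈ε ⟩
    ε                ∎))
    where
    open SetoidReasoning setoid
    y = (2 ^ k) · t

  FS-period⇒≈ε : NoOrder2 → ∀ A {t} → FS A ≐ (FS A ⊕ t) → t ≈ ε
  FS-period⇒≈ε noOrder2 A {t} FSA≐FSA⊕t =
    2^k·t≈ε⇒t≈ε noOrder2 (length A) (identityʳ-unique Σ⟨ FS A ⟩ _ (begin
      Σ⟨ FS A ⟩ ∙ ((2 ^ length A) · t)  ≈⟨ ∙-congˡ (×-congˡ (length-FS A)) ⟨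
      Σ⟨ FS A ⟩ ∙ (length (FS A) · t)   ≈⟨ Σ-⊕ (FS A) t ⟨
      Σ⟨ FS A ⊕ t ⟩                     ≈⟨ Σ-cong FSA≐FSA⊕t ⟨
      Σ⟨ FS A ⟩                         ∎))
    where open SetoidReasoning setoid

  ε∈FS : ∀ A → Any (ε ≈_) (FS A)
  ε∈FS []      = here refl
  ε∈FS (a ∷ A) = AnyP.++⁺ˡ (ε∈FS A)

  Any-FS⇒subset : ∀ {p} {Q : Carrier → Set p} A → Any Q (FS A) →
                  ∃[ B ] ∃[ C ] (A ≐ (B ++ C) × Q Σ⟨ B ⟩)
  Any-FS⇒subset []      (here q) = [] , [] , ↭-refl , q
  Any-FS⇒subset (a ∷ A) q∈ with AnyP.++⁻ (FS A) q∈
  ... | inj₁ q∈FSA with B , C , A≐B++C , q ← Any-FS⇒subset A q∈FSA =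
    B , a ∷ C , ↭-trans (↭-prep a A≐B++C) (↭-sym (PP.shift refl B C)) , q
  ... | inj₂ q∈aFSA with B , C , A≐B++C , q ← Any-FS⇒subset A (AnyP.map⁻ q∈aFSA) =
    a ∷ B , C , ↭-prep a A≐B++C , q

  ∼₀⇒FS≐ : (A A' : MSet) → A ∼₀ A' → FS A ≐ FS A'
  ∼₀⇒FS≐ A A' (B , C , A≐B++C , ΣB≈ε , A'≐C++negB) = begin
    FS A                ↭⟨ ⊕-identityʳ (FS A) ⟨
    FS A ⊕ ε            ↭⟨ ⊕-congˡ (FS A) (trans (⁻¹-cong ΣB≈ε) ε⁻¹≈ε) ⟨
    FS A ⊕ (Σ⟨ B ⟩ ⁻¹)  ↭⟨ FS-flip B C A≐B++C A'≐C++negB ⟨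
    FS A'               ∎
    where open PermutationReasoning

  ∼⇒FS≐⊕ : (A A' : MSet) → A ∼ A' → ∃[ g ] (FS A ≐ (FS A' ⊕ g))
  ∼⇒FS≐⊕ A A' (B , C , A≐B++C , A'≐C++negB) = Σ⟨ B ⟩ , (begin
    FS A                           ↭⟨ ⊕-identityʳ (FS A) ⟨
    FS A ⊕ ε                       ↭⟨ ⊕-congˡ (FS A) (inverseˡ Σ⟨ B ⟩) ⟨
    FS A ⊕ (Σ⟨ B ⟩ ⁻¹ ∙ Σ⟨ B ⟩)    ↭⟨ ⊕-assoc (FS A) (Σ⟨ B ⟩ ⁻¹) Σ⟨ B ⟩ ⟨
    (FS A ⊕ (Σ⟨ B ⟩ ⁻¹)) ⊕ Σ⟨ B ⟩  ↭⟨ ⊕-congʳ Σ⟨ B ⟩ (FS-flip B C A≐B++C A'≐C++negB) ⟨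
    FS A' ⊕ Σ⟨ B ⟩                 ∎)
    where open PermutationReasoning

  FS≐∧∼⇒∼₀ : (A A' : MSet) → NoOrder2 → FS A ≐ FS A' → A ∼ A' → A ∼₀ A'
  FS≐∧∼⇒∼₀ A A' noOrder2 FSA≐FSA' (B , C , A≐B++C , A'≐C++negB) =
    B , C , A≐B++C , ⁻¹-injective (trans ΣB⁻¹≈ε (sym ε⁻¹≈ε)) , A'≐C++negB
    where
    ΣB⁻¹≈ε : Σ⟨ B ⟩ ⁻¹ ≈ ε
    ΣB⁻¹≈ε = FS-period⇒≈ε noOrder2 A (↭-trans FSA≐FSA' (FS-flip B C A≐B++C A'≐C++negB))

  FS≐⊕⇒∼ : (A A' : MSet) (g : Carrier) → FS A ≐ (FS A' ⊕ g) → ∃[ A'' ] (A'' ∼ A' × FS A ≐ FS A'')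
  FS≐⊕⇒∼ A A' g FSA≐FSA'⊕g
    with B , C , A'≐B++C , ε≈ΣB∙g ← Any-FS⇒subset A' (AnyP.map⁻ (PP.∈-resp-↭ FSA≐FSA'⊕g (ε∈FS A))) =
    neg B ++ C ,
    (neg B , C , ↭-refl , ↭-trans A'≐B++C (↭-trans (PP.++-comm B C) (PP.++⁺ˡ C (neg-involutive B)))) ,
    (begin
      FS A                       ↭⟨ FSA≐FSA'⊕g ⟩
      FS A' ⊕ g                  ↭⟨ ⊕-congʳ g (FS-cong A'≐B++C) ⟩
      FS (B ++ C) ⊕ g            ↭⟨ ⊕-congˡ (FS (B ++ C)) (inverseʳ-unique Σ⟨ B ⟩ g (sym ε≈ΣB∙g)) ⟩
      FS (B ++ C) ⊕ (Σ⟨ B ⟩ ⁻¹)  ↭⟨ FS-neg-++ B C ⟨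
      FS (neg B ++ C)            ∎)
    where open PermutationReasoning

lemma3p3 : {c ℓ : Level} (G : AbelianGroup c ℓ) →
    let open AbelianGroup G
        open MS G
    in ((A A' : MSet) → A ∼₀ A' → FS A ≐ FS A')
       × ((A A' : MSet) → A ∼ A' → ∃[ g ] (FS A ≐ (FS A' ⊕ g)))
       × ((A A' : MSet) → NoOrder2 → FS A ≐ FS A' → A ∼ A' → A ∼₀ A')
       × ((A A' : MSet) (g : Carrier) → FS A ≐ (FS A' ⊕ g) →
            ∃[ A'' ] (A'' ∼ A' × FS A ≐ FS A''))
lemma3p3 G = ∼₀⇒FS≐ , ∼⇒FS≐⊕ , FS≐∧∼⇒∼₀ , FS≐⊕⇒∼
  where open SubsetSums G
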